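{- For $m \geq 3$ and $n \geq 6$, writing $n=3k$, $3k+1$ or $3k+2$ with $k$ a positive integer, $$\gamma(C_n\times K_m)\leq \begin{cases} 2k, & n=3k;\\ 2k+1, & n=3k+1;\\ 2k+2, & n=3k+2.\end{cases}$$
   Context: $C_n$ is the cycle on $\{1,\dots,n\}$ with edges $\{i,i+1\}$ and $\{n,1\}$; $K_m$ is the complete graph on $\{1,\dots,m\}$. The direct product $G\times H$ has vertex set $V(G)\times V(H)$ with $(g_1,h_1)\sim(g_2,h_2)$ iff $g_1g_2\in E(G)$ and $h_1h_2\in E(H)$. $\gamma(G)$ denotes the domination number: the minimum size of a set $D$ of vertices such that every vertex not in $D$ is adjacent to a vertex of $D$. -}

module Defs where

open import Data.Nat using (ℕ; _+_; _*_; _≤_; _∸_)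
open import Data.Nat as ℕ using ()
open import Data.Nat.DivMod using (_/_; _%_)
open import Data.Fin using (Fin; toℕ; zero; suc)
open import Data.Fin.Subset using (Subset; _∈_; ∣_∣)
open import Data.Product using (_×_; _,_; Σ; ∃; ∃-syntax)
open import Data.Sum using (_⊎_)
open import Relation.Binary.PropositionalEquality using (_≡_; _≢_)

record Graph (v : ℕ) : Set₁ where
  field
    Adj : Fin v → Fin v → Set

open Graph public

-- The cycle C_n on vertices {1,…,n}, represented as Fin n = {0,…,n-1}
-- (vertex t+1 of the paper is index t): consecutive vertices are adjacent,
-- and the last vertex n-1 is adjacent to 0.
CycleStep : (n : ℕ) → Fin n → Fin n → Set
CycleStep n i j = (toℕ j ≡ ℕ.suc (toℕ i)) ⊎ ((toℕ i ≡ n ∸ 1) × (toℕ j ≡ 0))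

Cycle : (n : ℕ) → Graph n
Adj (Cycle n) i j = CycleStep n i j ⊎ CycleStep n j i

Complete : (m : ℕ) → Graph m
Adj (Complete m) i j = i ≢ j

DirectAdj : ∀ {a b} → Graph a → Graph b → (Fin a × Fin b) → (Fin a × Fin b) → Set
DirectAdj G H (g₁ , h₁) (g₂ , h₂) = Adj G g₁ g₂ × Adj H h₁ h₂

-- D (a subset of V(G) × V(H), given as a subset of V(H) for each vertex of G)
-- dominates G × H: every vertex not in D is adjacent to a vertex in D
-- (stated equivalently as: every vertex is in D or adjacent to a vertex of D).
DominatesDirect : ∀ {a b} (G : Graph a) (H : Graph b) → (Fin a → Subset b) → Set
DominatesDirect G H D =
  ∀ x y → (y ∈ D x) ⊎ (∃[ x' ] ∃[ y' ] (y' ∈ D x' × DirectAdj G H (x , y) (x' , y')))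

sizeOf : ∀ {a b} → (Fin a → Subset b) → ℕ
sizeOf {ℕ.zero} D = 0
sizeOf {ℕ.suc a} D = ∣ D zero ∣ + sizeOf (λ i → D (suc i))

DirectDominationAtMost : ∀ {a b} (G : Graph a) (H : Graph b) → ℕ → Set
DirectDominationAtMost G H t =
  Σ (Fin _ → Subset _) λ D → DominatesDirect G H D × sizeOf D ≤ t

-- The bound of the paper: n = 3k ↦ 2k, n = 3k+1 ↦ 2k+1, n = 3k+2 ↦ 2k+2,
-- i.e. 2 * (n / 3) + n % 3.
bound : ℕ → ℕ
bound n = 2 * (n / 3) + n % 3

-- Give each vertex x of C_n at most one partner colour c x ∈ V(K_m) and put (x, c x) in D.
-- A vertex (x, y) is then dominated as soon as x has a neighbour x' with c x' = c x
-- (either y = c x or (x', c x) is adjacent to (x, y)), or two neighbours of different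
-- colours (y differs from one of them). Writing n = 3k + r, cut C_n into k blocks of
-- three vertices, colour the first two vertices of each block and leave the third one
-- uncoloured, and colour each of the r remaining vertices 0. The block colours alternate
-- 0, 1, 0, … except that the last block gets colour 2, so consecutive blocks differ, and
-- k ≥ 2 makes the first block 0 like the remaining vertices that precede it on the cycle.
-- This uses 2k + r vertices.
module Submission where

open import Defs
open import Data.Bool using (Bool; true; false; not)
open import Data.Fin as Fin using (Fin; toℕ; fromℕ<; #_; _≟_)
open import Data.Fin.Properties using (toℕ-fromℕ<; toℕ<n)
open import Data.Fin.Subset using (Subset; _∈_; ∣_∣; ⁅_⁆; ⊥)
open import Data.Fin.Subset.Properties using (x∈⁅x⁆; ∣⁅x⁆∣≡1; ∣⊥∣≡0)
open import Data.Maybe using (Maybe; just; nothing)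
open import Data.Nat using (ℕ; zero; suc; _≤_; _<_; _+_; _*_; z≤n; s≤s)
open import Data.Nat.DivMod using (_/_; _%_; m≡m%n+[m/n]*n; /-monoˡ-≤)
open import Data.Nat.Properties using (suc-injective; m≤n⇒m<n∨m≡n; <⇒≤; ≤-reflexive; *-suc; +-comm)
open import Data.Product using (_×_; _,_; ∃-syntax)
open import Data.Sum using (inj₁; inj₂)
open import Function using (_∘_)
open import Relation.Binary.PropositionalEquality
  using (_≡_; _≢_; refl; sym; trans; cong; cong₂; subst; module ≡-Reasoning)
open import Relation.Nullary using (yes; no)

toSubset : ∀ {m} → Maybe (Fin m) → Subset m
toSubset (just c) = ⁅ c ⁆
toSubset nothing  = ⊥

∈-toSubset : ∀ {m} {s : Maybe (Fin m)} {c} → s ≡ just c → c ∈ toSubset s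
∈-toSubset refl = x∈⁅x⁆ _

sizeOf-singletons : ∀ a {m} (f : Fin a → Fin m) → sizeOf (λ x → ⁅ f x ⁆) ≡ a
sizeOf-singletons zero    f = refl
sizeOf-singletons (suc a) f = cong₂ _+_ (∣⁅x⁆∣≡1 (f Fin.zero)) (sizeOf-singletons a (f ∘ Fin.suc))

data DominatedAt {a m} (G : Graph a) (f : Fin a → Maybe (Fin m)) (x : Fin a) : Set where
  twin    : ∀ {x' c} → Adj G x x' → f x ≡ just c → f x' ≡ just c → DominatedAt G f x
  between : ∀ {x₁ x₂ c₁ c₂} → Adj G x x₁ → Adj G x x₂ →
            f x₁ ≡ just c₁ → f x₂ ≡ just c₂ → c₁ ≢ c₂ → DominatedAt G f x

labelling-dominates : ∀ {a m} (G : Graph a) (f : Fin a → Maybe (Fin m)) →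
  (∀ x → DominatedAt G f x) → DominatesDirect G (Complete m) (toSubset ∘ f)
labelling-dominates G f dominated x y with dominated x
... | twin {x'} {c} x~x' fx≡c fx'≡c with y ≟ c
...   | yes refl = inj₁ (∈-toSubset fx≡c)
...   | no y≢c   = inj₂ (x' , c , ∈-toSubset fx'≡c , x~x' , y≢c)
labelling-dominates G f dominated x y
    | between {x₁} {x₂} {c₁} {c₂} x~x₁ x~x₂ fx₁≡c₁ fx₂≡c₂ c₁≢c₂ with y ≟ c₁
... | yes refl = inj₂ (x₂ , c₂ , ∈-toSubset fx₂≡c₂ , x~x₂ , c₁≢c₂)
... | no y≢c₁  = inj₂ (x₁ , c₁ , ∈-toSubset fx₁≡c₁ , x~x₁ , y≢c₁)

data PathDominatedAt {m} (ℓ : ℕ → Maybe (Fin m)) (p : ℕ) : Set where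
  twin-next : ∀ {c} → ℓ p ≡ just c → ℓ (suc p) ≡ just c → PathDominatedAt ℓ p
  twin-prev : ∀ {q c} → p ≡ suc q → ℓ p ≡ just c → ℓ q ≡ just c → PathDominatedAt ℓ p
  between   : ∀ {q c₁ c₂} → p ≡ suc q →
              ℓ q ≡ just c₁ → ℓ (suc p) ≡ just c₂ → c₁ ≢ c₂ → PathDominatedAt ℓ p

suc-dominated : ∀ {m} {ℓ : ℕ → Maybe (Fin m)} {p} →
  PathDominatedAt (ℓ ∘ suc) p → PathDominatedAt ℓ (suc p)
suc-dominated (twin-next ℓp ℓp+1)           = twin-next ℓp ℓp+1
suc-dominated (twin-prev p≡q+1 ℓp ℓq)       = twin-prev (cong suc p≡q+1) ℓp ℓq
suc-dominated (between p≡q+1 ℓq ℓp+1 c₁≢c₂) = between (cong suc p≡q+1) ℓq ℓp+1 c₁≢c₂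

-- The hypothesis ℓ n ≡ ℓ 0 lets position n stand for the successor 0 of the last vertex of C_n.
next-neighbour : ∀ {n m} (ℓ : ℕ → Maybe (Fin m)) → ℓ n ≡ ℓ 0 → (x : Fin n) →
  ∃[ x' ] (Adj (Cycle n) x x' × ℓ (toℕ x') ≡ ℓ (suc (toℕ x)))
next-neighbour {suc n} ℓ periodic x with m≤n⇒m<n∨m≡n (toℕ<n x)
... | inj₁ x+1<n = fromℕ< x+1<n , inj₁ (inj₁ (toℕ-fromℕ< x+1<n)) , cong ℓ (toℕ-fromℕ< x+1<n)
... | inj₂ x+1≡n =
  Fin.zero , inj₁ (inj₂ (suc-injective x+1≡n , refl)) , trans (sym periodic) (cong ℓ (sym x+1≡n))

prev-neighbour : ∀ {n q} (x : Fin n) → toℕ x ≡ suc q → ∃[ x' ] (Adj (Cycle n) x x' × toℕ x' ≡ q)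
prev-neighbour {n} {q} x x≡q+1 =
  fromℕ< q<n , inj₂ (inj₁ (trans x≡q+1 (cong suc (sym (toℕ-fromℕ< q<n))))) , toℕ-fromℕ< q<n
  where
  q<n : q < n
  q<n = <⇒≤ (subst (_< n) x≡q+1 (toℕ<n x))

cycle-dominated : ∀ {n m} (ℓ : ℕ → Maybe (Fin m)) → ℓ n ≡ ℓ 0 →
  (∀ p → PathDominatedAt ℓ p) → ∀ x → DominatedAt (Cycle n) (ℓ ∘ toℕ) x
cycle-dominated ℓ periodic dominated x with dominated (toℕ x)
... | twin-next ℓx ℓx+1 =
  let x' , x~x' , ℓx'≡ℓx+1 = next-neighbour ℓ periodic x
  in twin x~x' ℓx (trans ℓx'≡ℓx+1 ℓx+1)
... | twin-prev x≡q+1 ℓx ℓq =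
  let x' , x~x' , x'≡q = prev-neighbour x x≡q+1
  in twin x~x' ℓx (trans (cong ℓ x'≡q) ℓq)
... | between x≡q+1 ℓq ℓx+1 c₁≢c₂ =
  let x₁ , x~x₁ , x₁≡q = prev-neighbour x x≡q+1
      x₂ , x~x₂ , ℓx₂≡ℓx+1 = next-neighbour ℓ periodic x
  in between x~x₁ x~x₂ (trans (cong ℓ x₁≡q) ℓq) (trans ℓx₂≡ℓx+1 ℓx+1) c₁≢c₂

module _ {m : ℕ} where

  -- The colour of a block, given the parity of its index and the number of blocks after it.
  colour : Bool → ℕ → Fin (3 + m)
  colour _     zero    = # 2
  colour false (suc _) = # 0
  colour true  (suc _) = # 1

  colour-alternates : ∀ b k → colour b (suc k) ≢ colour (not b) k
  colour-alternates false zero    = λ ()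
  colour-alternates false (suc k) = λ ()
  colour-alternates true  zero    = λ ()
  colour-alternates true  (suc k) = λ ()

  blocks : Bool → ℕ → ℕ → Maybe (Fin (3 + m))
  blocks b zero    p = just (# 0)
  blocks b (suc k) 0 = just (colour b k)
  blocks b (suc k) 1 = just (colour b k)
  blocks b (suc k) 2 = nothing
  blocks b (suc k) (suc (suc (suc p))) = blocks (not b) k p

  blocks-dominated : ∀ b k p → PathDominatedAt (blocks b k) p
  blocks-dominated b zero          p = twin-next refl refl
  blocks-dominated b (suc k)       0 = twin-next refl refl
  blocks-dominated b (suc k)       1 = twin-prev refl refl refl
  blocks-dominated b (suc zero)    2 = between refl refl refl λ ()
  blocks-dominated b (suc (suc k)) 2 = between refl refl refl (colour-alternates b k)
  blocks-dominated b (suc k) (suc (suc (suc p))) =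
    suc-dominated (suc-dominated (suc-dominated (blocks-dominated (not b) k p)))

  blocks-beyond : ∀ b k r → blocks b k (k * 3 + r) ≡ just (# 0)
  blocks-beyond b zero    r = refl
  blocks-beyond b (suc k) r = blocks-beyond (not b) k r

  blocks-periodic : ∀ k r → 2 ≤ k → blocks false k (k * 3 + r) ≡ blocks false k 0
  blocks-periodic (suc (suc k)) r (s≤s (s≤s z≤n)) = blocks-beyond false (2 + k) r

  blocks-size : ∀ b k r → sizeOf {k * 3 + r} (toSubset ∘ blocks b k ∘ toℕ) ≡ 2 * k + r
  blocks-size b zero    r = sizeOf-singletons r (λ _ → # 0)
  blocks-size b (suc k) r = begin
    ∣ ⁅ c ⁆ ∣ + (∣ ⁅ c ⁆ ∣ + (∣ ⊥ {3 + m} ∣ + sizeOf {k * 3 + r} (toSubset ∘ blocks (not b) k ∘ toℕ)))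
      ≡⟨ cong₂ _+_ (∣⁅x⁆∣≡1 c)
           (cong₂ _+_ (∣⁅x⁆∣≡1 c) (cong₂ _+_ (∣⊥∣≡0 (3 + m)) (blocks-size (not b) k r))) ⟩
    2 + 2 * k + r
      ≡⟨ cong (_+ r) (*-suc 2 k) ⟨
    2 * suc k + r ∎
    where
    open ≡-Reasoning
    c : Fin (3 + m)
    c = colour b k

cycle-times-complete-domination : ∀ m k r → 2 ≤ k →
  DirectDominationAtMost (Cycle (k * 3 + r)) (Complete (3 + m)) (2 * k + r)
cycle-times-complete-domination m k r 2≤k =
  toSubset ∘ ℓ ∘ toℕ ,
  labelling-dominates (Cycle _) (ℓ ∘ toℕ)
    (cycle-dominated ℓ (blocks-periodic k r 2≤k) (blocks-dominated false k)) ,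
  ≤-reflexive (blocks-size false k r)
  where
  ℓ : ℕ → Maybe (Fin (3 + m))
  ℓ = blocks false k

proposition4p1 : (m n : ℕ) → 3 ≤ m → 6 ≤ n →
    DirectDominationAtMost (Cycle n) (Complete m) (bound n)
proposition4p1 (suc (suc (suc m))) n (s≤s (s≤s (s≤s z≤n))) 6≤n =
  subst (λ n′ → DirectDominationAtMost (Cycle n′) (Complete (3 + m)) (bound n)) (sym n≡k*3+r)
    (cycle-times-complete-domination m (n / 3) (n % 3) (/-monoˡ-≤ 3 6≤n))
  where
  n≡k*3+r : n ≡ n / 3 * 3 + n % 3
  n≡k*3+r = trans (m≡m%n+[m/n]*n n 3) (+-comm (n % 3) (n / 3 * 3))
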